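{- $\tau_5(S_3)<\tau_5(T_3)$.
   Context: $S_3$ is the star with $3$ leaves and $T_3$ is the infinite $3$-regular tree. For an integer $t\ge1$, a $t$-tone coloring of a graph $G$ assigns to each vertex $v$ a set $f(v)$ of exactly $t$ colors from a color set $C$ such that $|f(u)\cap f(v)|<d(u,v)$ for all distinct $u,v$, where $d$ is graph distance; $\tau_t(G)$ is the minimum $|C|$ over all such colorings. -}

module Defs where

open import Data.Nat using (ℕ; _<_)
open import Data.Fin using (Fin)
open Fin
open import Data.Fin.Subset using (Subset; _∩_; ∣_∣)
open import Data.List using (List; []; _∷_)
open import Data.Product using (∃; ∃-syntax; _×_; _,_)
open import Data.Sum using (_⊎_)
open import Relation.Binary.PropositionalEquality using (_≡_; _≢_)
open import Relation.Nullary using (¬_)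

record Graph : Set₁ where
  field
    V   : Set
    Adj : V → V → Set
open Graph public

data Walk (G : Graph) : V G → V G → ℕ → Set where
  nil  : ∀ {u} → Walk G u u ℕ.zero
  cons : ∀ {u w v n} → Adj G u w → Walk G w v n → Walk G u v (ℕ.suc n)

-- "m < d(u,v)", where d(u,v) is the graph distance (the least length of
-- a walk from u to v; infinite if there is none): every walk from u to v
-- has length greater than m.
_<dist[_]_,_ : ℕ → (G : Graph) → V G → V G → Set
m <dist[ G ] u , v = ∀ {n} → Walk G u v n → m < n

IsToneColoring : (G : Graph) (t k : ℕ) → (V G → Subset k) → Set
IsToneColoring G t k f =
  (∀ v → ∣ f v ∣ ≡ t) ×
  (∀ u v → u ≢ v → ∣ f u ∩ f v ∣ <dist[ G ] u , v)

-- G has a t-tone coloring with k colors (i.e. τ_t(G) ≤ k).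
HasToneColoring : (G : Graph) (t k : ℕ) → Set
HasToneColoring G t k = ∃[ f ] IsToneColoring G t k f

data StarAdj : Fin 4 → Fin 4 → Set where
  c→l : ∀ {i : Fin 3} → StarAdj zero (suc i)
  l→c : ∀ {i : Fin 3} → StarAdj (suc i) zero

S₃ : Graph
S₃ = record { V = Fin 4 ; Adj = StarAdj }

-- A non-root vertex is given by its
-- path from the root: a first step (one of 3 neighbours of the root),
-- followed by a list of further steps (each non-root vertex has 2
-- children), the most recent step at the head of the list.
data T3V : Set where
  root : T3V
  node : Fin 3 → List (Fin 2) → T3V

data ChildOf : T3V → T3V → Set where
  root-child : ∀ {i} → ChildOf root (node i [])
  node-child : ∀ {i xs b} → ChildOf (node i xs) (node i (b ∷ xs))

T3Adj : T3V → T3V → Set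
T3Adj u v = ChildOf u v ⊎ ChildOf v u

T₃ : Graph
T₃ = record { V = T3V ; Adj = T3Adj }

module Submission where

-- Upper bound: a 5-tone colouring of S₃ with 17 colours gives the centre 5
-- colours and each leaf 5 further ones, any two leaves sharing exactly one.
--
-- Lower bound: take the root r of T₃, its children a, b, c and the children
-- x, y of a. For every colour γ, writing [v] for "γ ∈ f v",
--   3[r] + 3[a] + 2([b] + [c] + [x] + [y]) ≤ 3 + Σ w_uv [u][v]
-- for suitable pair weights w_uv (checked over all 64 patterns). Summing over
-- the k colours turns [v] into |f v| = 5 and [u][v] into |f u ∩ f v| ≤ d(u,v) − 1,
-- giving 70 ≤ 3k + 18, so k ≥ 18.

open import Defs
import Algebra.Properties.CommutativeSemigroup
open import Data.Bool using (_∧_; if_then_else_)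
open import Data.Fin using (Fin; zero; suc; #_)
open import Data.Fin.Subset using (Subset; _∩_; ∣_∣; ⁅_⁆; ⋃; inside; outside)
open import Data.Fin.Subset.Properties using (∩-idem; anySubset?)
open import Data.List using (List; []; _∷_; map)
open import Data.List.Relation.Unary.All using (All; []; _∷_)
open import Data.Nat using (ℕ; zero; suc; _+_; _*_; _≤_; _≤?_; z≤n; s≤s; pred)
open import Data.Nat.Properties
  using ( +-mono-≤; +-monoʳ-≤; *-monoʳ-≤; *-zeroʳ; *-distribˡ-+; ≤-reflexive; ≤-pred; 1+n≰n
        ; +-commutativeSemigroup; module ≤-Reasoning)
open import Data.Product using (∃-syntax; _×_; _,_)
open import Data.Sum using (inj₁; inj₂)
open import Data.Vec using (Vec; []; _∷_; head; tail; lookup; tabulate)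
open import Data.Vec.Properties using (lookup∘tabulate)
open import Function using (_∘_; _∘₂_)
open import Relation.Binary.PropositionalEquality
  using (_≡_; _≢_; refl; sym; trans; cong; cong₂; module ≡-Reasoning)
open import Relation.Nullary using (¬_; Dec; contradiction; ¬?)
open import Relation.Nullary.Decidable using (from-no; decidable-stable)
open import Relation.Nullary.Negation using (¬∃⟶∀¬)

open Algebra.Properties.CommutativeSemigroup +-commutativeSemigroup
  using () renaming (interchange to +-interchange)

private
  variable
    m n : ℕ

record WeightedPair (m : ℕ) : Set where
  constructor _·⟨_,_⟩
  field
    weight      : ℕ
    left right  : Fin m
open WeightedPair

weightedSum : List (WeightedPair m) → (Fin m → Fin m → ℕ) → ℕ
weightedSum []       g = 0
weightedSum (p ∷ ps) g = weight p * g (left p) (right p) + weightedSum ps g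

weightedSum-mono : ∀ {g h : Fin m → Fin m → ℕ} {ps} →
                   All (λ p → g (left p) (right p) ≤ h (left p) (right p)) ps →
                   weightedSum ps g ≤ weightedSum ps h
weightedSum-mono {ps = p ∷ _} (g≤h ∷ gs≤hs) =
  +-mono-≤ (*-monoʳ-≤ (weight p) g≤h) (weightedSum-mono gs≤hs)
weightedSum-mono {ps = []}    []            = z≤n

weightedSum-zero : {g : Fin m → Fin m → ℕ} → (∀ i j → g i j ≡ 0) →
                   ∀ ps → weightedSum ps g ≡ 0
weightedSum-zero g≡0 []       = refl
weightedSum-zero g≡0 (p ∷ ps) rewrite g≡0 (left p) (right p) | *-zeroʳ (weight p) =
  weightedSum-zero g≡0 ps

weightedSum-+ : {g h k : Fin m → Fin m → ℕ} → (∀ i j → g i j ≡ h i j + k i j) →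
                ∀ ps → weightedSum ps g ≡ weightedSum ps h + weightedSum ps k
weightedSum-+ g≡h+k [] = refl
weightedSum-+ {g = g} {h} {k} g≡h+k (p ∷ ps) = begin
  w * g i j + weightedSum ps g
    ≡⟨ cong₂ _+_ (trans (cong (w *_) (g≡h+k i j)) (*-distribˡ-+ w (h i j) (k i j)))
                 (weightedSum-+ g≡h+k ps) ⟩
  (w * h i j + w * k i j) + (weightedSum ps h + weightedSum ps k)
    ≡⟨ +-interchange (w * h i j) (w * k i j) (weightedSum ps h) (weightedSum ps k) ⟩
  (w * h i j + weightedSum ps h) + (w * k i j + weightedSum ps k)
    ∎
  where
  open ≡-Reasoning
  w = weight p
  i = left p
  j = right p

shared : (Fin m → Subset n) → Fin m → Fin m → ℕ
shared F i j = ∣ F i ∩ F j ∣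

jointly : Subset m → Fin m → Fin m → ℕ
jointly S i j = if lookup S i ∧ lookup S j then 1 else 0

∣∩∣-[] : (x y : Subset 0) → ∣ x ∩ y ∣ ≡ 0
∣∩∣-[] [] [] = refl

∣∩∣-∷ : (x y : Subset (suc n)) →
        ∣ x ∩ y ∣ ≡ (if head x ∧ head y then 1 else 0) + ∣ tail x ∩ tail y ∣
∣∩∣-∷ (inside  ∷ x) (inside  ∷ y) = refl
∣∩∣-∷ (inside  ∷ x) (outside ∷ y) = refl
∣∩∣-∷ (outside ∷ x) (inside  ∷ y) = refl
∣∩∣-∷ (outside ∷ x) (outside ∷ y) = refl

firstColour : (Fin m → Subset (suc n)) → Subset m
firstColour F = tabulate (head ∘ F)

shared-firstColour : (F : Fin m → Subset (suc n)) → ∀ i j →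
                     shared F i j ≡ jointly (firstColour F) i j + shared (tail ∘ F) i j
shared-firstColour F i j
  rewrite lookup∘tabulate (head ∘ F) i | lookup∘tabulate (head ∘ F) j = ∣∩∣-∷ (F i) (F j)

-- S ranges over the possible sets of vertices carrying one given colour.
weightedSum-colourwise : ∀ {P Q : List (WeightedPair m)} {a} →
  (∀ S → weightedSum P (jointly S) ≤ a + weightedSum Q (jointly S)) →
  (F : Fin m → Subset n) → weightedSum P (shared F) ≤ n * a + weightedSum Q (shared F)
weightedSum-colourwise {n = zero} {P = P} _ F
  rewrite weightedSum-zero {g = shared F} (λ i j → ∣∩∣-[] (F i) (F j)) P = z≤n
weightedSum-colourwise {n = suc n} {P = P} {Q = Q} {a = a} P≤a+Q F = begin
  weightedSum P (shared F)
    ≡⟨ weightedSum-+ (shared-firstColour F) P ⟩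
  weightedSum P (jointly S) + weightedSum P (shared F′)
    ≤⟨ +-mono-≤ (P≤a+Q S) (weightedSum-colourwise {P = P} {Q = Q} P≤a+Q F′) ⟩
  (a + weightedSum Q (jointly S)) + (n * a + weightedSum Q (shared F′))
    ≡⟨ +-interchange a _ (n * a) _ ⟩
  suc n * a + (weightedSum Q (jointly S) + weightedSum Q (shared F′))
    ≡⟨ cong (suc n * a +_) (weightedSum-+ (shared-firstColour F) Q) ⟨
  suc n * a + weightedSum Q (shared F)
    ∎
  where
  open ≤-Reasoning
  S  = firstColour F
  F′ = tail ∘ F

module _ {G : Graph} {u v : V G} where

  distinct⇒0<dist : u ≢ v → 0 <dist[ G ] u , v
  distinct⇒0<dist u≢v nil        = contradiction refl u≢v
  distinct⇒0<dist u≢v (cons _ _) = s≤s z≤n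

  nonadjacent⇒1<dist : u ≢ v → ¬ Adj G u v → 1 <dist[ G ] u , v
  nonadjacent⇒1<dist u≢v _    nil                 = contradiction refl u≢v
  nonadjacent⇒1<dist u≢v ¬adj (cons adj nil)      = contradiction adj ¬adj
  nonadjacent⇒1<dist u≢v ¬adj (cons _ (cons _ _)) = s≤s (s≤s z≤n)

infixr 5 _◅_
_◅_ : ∀ {G : Graph} {u w v : V G} {n} → Adj G u w → Walk G w v n → Walk G u v (suc n)
_◅_ = cons

colours : List (Fin n) → Subset n
colours = ⋃ ∘ map ⁅_⁆

starColouring : Fin 4 → Subset 17
starColouring zero                   = colours (# 0 ∷ # 1 ∷ # 2  ∷ # 3  ∷ # 4  ∷ [])
starColouring (suc zero)             = colours (# 5 ∷ # 6 ∷ # 8  ∷ # 9  ∷ # 10 ∷ [])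
starColouring (suc (suc zero))       = colours (# 5 ∷ # 7 ∷ # 11 ∷ # 12 ∷ # 13 ∷ [])
starColouring (suc (suc (suc zero))) = colours (# 6 ∷ # 7 ∷ # 14 ∷ # 15 ∷ # 16 ∷ [])

starColouring-isToneColoring : IsToneColoring S₃ 5 17 starColouring
starColouring-isToneColoring = size , separated
  where
  size : ∀ v → ∣ starColouring v ∣ ≡ 5
  size zero                   = refl
  size (suc zero)             = refl
  size (suc (suc zero))       = refl
  size (suc (suc (suc zero))) = refl

  separated : ∀ u v → u ≢ v → ∣ starColouring u ∩ starColouring v ∣ <dist[ S₃ ] u , v
  separated zero                   zero                   u≢v = contradiction refl u≢v
  separated zero                   (suc zero)             u≢v = distinct⇒0<dist u≢v
  separated zero                   (suc (suc zero))       u≢v = distinct⇒0<dist u≢v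
  separated zero                   (suc (suc (suc zero))) u≢v = distinct⇒0<dist u≢v
  separated (suc zero)             zero                   u≢v = distinct⇒0<dist u≢v
  separated (suc zero)             (suc zero)             u≢v = contradiction refl u≢v
  separated (suc zero)             (suc (suc zero))       u≢v = nonadjacent⇒1<dist u≢v λ ()
  separated (suc zero)             (suc (suc (suc zero))) u≢v = nonadjacent⇒1<dist u≢v λ ()
  separated (suc (suc zero))       zero                   u≢v = distinct⇒0<dist u≢v
  separated (suc (suc zero))       (suc zero)             u≢v = nonadjacent⇒1<dist u≢v λ ()
  separated (suc (suc zero))       (suc (suc zero))       u≢v = contradiction refl u≢v
  separated (suc (suc zero))       (suc (suc (suc zero))) u≢v = nonadjacent⇒1<dist u≢v λ ()
  separated (suc (suc (suc zero))) zero                   u≢v = distinct⇒0<dist u≢v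
  separated (suc (suc (suc zero))) (suc zero)             u≢v = nonadjacent⇒1<dist u≢v λ ()
  separated (suc (suc (suc zero))) (suc (suc zero))       u≢v = nonadjacent⇒1<dist u≢v λ ()
  separated (suc (suc (suc zero))) (suc (suc (suc zero))) u≢v = contradiction refl u≢v

r a b c x y : Fin 6
r = # 0
a = # 1
b = # 2
c = # 3
x = # 4
y = # 5

vertex : Fin 6 → T3V
vertex = lookup (root ∷ node (# 0) [] ∷ node (# 1) [] ∷ node (# 2) [] ∷
                 node (# 0) (# 0 ∷ []) ∷ node (# 0) (# 1 ∷ []) ∷ [])

distance : Fin 6 → Fin 6 → ℕ
distance i j = lookup (lookup matrix i) j
  where
  matrix : Vec (Vec ℕ 6) 6
  matrix = (0 ∷ 1 ∷ 1 ∷ 1 ∷ 2 ∷ 2 ∷ [])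
         ∷ (1 ∷ 0 ∷ 2 ∷ 2 ∷ 1 ∷ 1 ∷ [])
         ∷ (1 ∷ 2 ∷ 0 ∷ 2 ∷ 3 ∷ 3 ∷ [])
         ∷ (1 ∷ 2 ∷ 2 ∷ 0 ∷ 3 ∷ 3 ∷ [])
         ∷ (2 ∷ 1 ∷ 3 ∷ 3 ∷ 0 ∷ 2 ∷ [])
         ∷ (2 ∷ 1 ∷ 3 ∷ 3 ∷ 2 ∷ 0 ∷ [])
         ∷ []

vertexWeights : List (WeightedPair 6)
vertexWeights = 3 ·⟨ r , r ⟩ ∷ 3 ·⟨ a , a ⟩
              ∷ 2 ·⟨ b , b ⟩ ∷ 2 ·⟨ c , c ⟩ ∷ 2 ·⟨ x , x ⟩ ∷ 2 ·⟨ y , y ⟩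
              ∷ []

-- The weight 4 on adjacent pairs costs nothing, as they share no colour.
pairWeights : List (WeightedPair 6)
pairWeights = 4 ·⟨ r , a ⟩ ∷ 4 ·⟨ r , b ⟩ ∷ 4 ·⟨ r , c ⟩ ∷ 4 ·⟨ a , x ⟩ ∷ 4 ·⟨ a , y ⟩
            ∷ 1 ·⟨ b , c ⟩ ∷ 1 ·⟨ x , y ⟩ ∷ 2 ·⟨ a , b ⟩ ∷ 2 ·⟨ a , c ⟩ ∷ 2 ·⟨ r , x ⟩ ∷ 2 ·⟨ r , y ⟩
            ∷ 1 ·⟨ b , x ⟩ ∷ 1 ·⟨ b , y ⟩ ∷ 1 ·⟨ c , x ⟩ ∷ 1 ·⟨ c , y ⟩
            ∷ []

ColourInequality : Subset 6 → Set
ColourInequality S =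
  weightedSum vertexWeights (jointly S) ≤ 3 + weightedSum pairWeights (jointly S)

colourInequality : ∀ S → ColourInequality S
colourInequality S =
  decidable-stable (inequality? S) (¬∃⟶∀¬ (from-no (anySubset? (¬? ∘ inequality?))) S)
  where
  inequality? : ∀ S → Dec (ColourInequality S)
  inequality? S = _ ≤? _

up : ∀ {p q} → ChildOf p q → Adj T₃ q p
up = inj₂

down : ∀ {p q} → ChildOf p q → Adj T₃ p q
down = inj₁

T₃-has-no-5-tone-colouring-with-17 : ¬ HasToneColoring T₃ 5 17
T₃-has-no-5-tone-colouring-with-17 (f , size , separated) = 1+n≰n (begin
  70                                                  ≤⟨ weightedSum-mono lowerBounds ⟩
  weightedSum vertexWeights (shared F)                ≤⟨ summedOverColours ⟩
  17 * 3 + weightedSum pairWeights (shared F)         ≤⟨ +-monoʳ-≤ (17 * 3) (weightedSum-mono upperBounds) ⟩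
  17 * 3 + weightedSum pairWeights (pred ∘₂ distance) ≡⟨⟩
  69                                                  ∎)
  where
  open ≤-Reasoning
  F : Fin 6 → Subset 17
  F = f ∘ vertex

  summedOverColours :
    weightedSum vertexWeights (shared F) ≤ 17 * 3 + weightedSum pairWeights (shared F)
  summedOverColours =
    weightedSum-colourwise {P = vertexWeights} {Q = pairWeights} {a = 3} colourInequality F

  shared-self : ∀ i → 5 ≤ shared F i i
  shared-self i = ≤-reflexive (sym (trans (cong ∣_∣ (∩-idem (F i))) (size (vertex i))))

  lowerBounds : All (λ p → 5 ≤ shared F (left p) (right p)) vertexWeights
  lowerBounds = shared-self r ∷ shared-self a ∷ shared-self b
              ∷ shared-self c ∷ shared-self x ∷ shared-self y ∷ []

  within : ∀ i j {d} → vertex i ≢ vertex j → Walk T₃ (vertex i) (vertex j) (suc d) →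
           shared F i j ≤ d
  within _ _ i≢j w = ≤-pred (separated _ _ i≢j w)

  upperBounds :
    All (λ p → shared F (left p) (right p) ≤ pred (distance (left p) (right p))) pairWeights
  upperBounds = within r a (λ ()) (down root-child ◅ nil)
        ∷ within r b (λ ()) (down root-child ◅ nil)
        ∷ within r c (λ ()) (down root-child ◅ nil)
        ∷ within a x (λ ()) (down node-child ◅ nil)
        ∷ within a y (λ ()) (down node-child ◅ nil)
        ∷ within b c (λ ()) (up root-child ◅ down root-child ◅ nil)
        ∷ within x y (λ ()) (up node-child ◅ down node-child ◅ nil)
        ∷ within a b (λ ()) (up root-child ◅ down root-child ◅ nil)
        ∷ within a c (λ ()) (up root-child ◅ down root-child ◅ nil)
        ∷ within r x (λ ()) (down root-child ◅ down node-child ◅ nil)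
        ∷ within r y (λ ()) (down root-child ◅ down node-child ◅ nil)
        ∷ within b x (λ ()) (up root-child ◅ down root-child ◅ down node-child ◅ nil)
        ∷ within b y (λ ()) (up root-child ◅ down root-child ◅ down node-child ◅ nil)
        ∷ within c x (λ ()) (up root-child ◅ down root-child ◅ down node-child ◅ nil)
        ∷ within c y (λ ()) (up root-child ◅ down root-child ◅ down node-child ◅ nil)
        ∷ []

proposition6p3 : ∃[ k ] (HasToneColoring S₃ 5 k × ¬ HasToneColoring T₃ 5 k)
proposition6p3 =
  17 , (starColouring , starColouring-isToneColoring) , T₃-has-no-5-tone-colouring-with-17
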